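{- Let $G=(V,\mathcal D,\ell_v)$ and $G'=(V',\mathcal D',\ell'_v)$ be finite node-labeled digraphs that are weakly connected, simple and oriented, and let $\mathcal L(G),\mathcal L(G')$ be their extended line digraphs. Let $W\subseteq\mathcal D$ and $W'\subseteq\mathcal D'$. Let $H,H'$ be the $W$ and $W'$ edge-induced subgraphs of $G$ and $G'$, and let $J,J'$ be the $W$ and $W'$ node-induced subgraphs of $\mathcal L(G)$ and $\mathcal L(G')$. Then (1) $\mathcal L(H)=J$ and $\mathcal L(H')=J'$, and (2) $H\cong H'$ if and only if $J\cong J'$.
   Context: A node-labeled digraph $G=(V,\mathcal D,\ell_v)$ consists of a finite node set $V$, directed edges $\mathcal D\subseteq V\times V$, and a node-labeling function $\ell_v$; a labeled digraph additionally has an edge-labeling function $\ell_e$. Weakly connected: underlying undirected graph connected. Simple: no self-loops and no parallel edges with the same source and target. Oriented: no pair $(u,v),(v,u)$ both in $\mathcal D$. For $W\subseteq\mathcal D$, the $W$ edge-induced subgraph is $(U_W,W,\ell_v|_{U_W})$ with $U_W$ the set of endpoints of edges in $W$. For a node subset $U$ of a labeled digraph, the $U$ node-induced subgraph has node set $U$, all edges of the graph with both ends in $U$, and the restricted labelings. Isomorphism of labeled digraphs: a bijection of node sets preserving node labels, with edges mapping to edges and non-edges to non-edges, and preserving edge labels (for node-labeled digraphs the edge-label condition is omitted). The extended line digraph of a simple node-labeled digraph $G=(V,\mathcal D,\ell_v)$ is the labeled digraph $\mathcal L(G)=(\mathcal D,\mathcal D_L,\bar\ell_v,\bar\ell_e)$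 with node set $\mathcal D$, node labels $\bar\ell_v((u,v))=(\ell_v(u),\ell_v(v))$, and, for distinct $e=(u,v),\hat e=(\hat u,\hat v)\in\mathcal D$: $(e,\hat e)\in\mathcal D_L$ with label $ht$ iff $v=\hat u$; $(e,\hat e),(\hat e,e)\in\mathcal D_L$ with label $tt$ iff $u=\hat u$; $(e,\hat e),(\hat e,e)\in\mathcal D_L$ with label $hh$ iff $v=\hat v$. -}

module Defs where

open import Data.Nat using (ℕ)
open import Data.Fin using (Fin)
open import Data.Fin.Properties using (_≟_)
open import Data.Bool using (Bool; true; false; _∧_; _∨_; not)
open import Data.Product using (Σ; _×_; _,_; proj₁; proj₂)
open import Data.List using (allFin)
open import Data.Bool.ListAction using (any)
open import Relation.Nullary.Decidable using (⌊_⌋)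
open import Relation.Binary.PropositionalEquality using (_≡_)

-- The node set is the subset {x | node x ≡ true} of N, the edge set is
-- the relation {(x,y) | edge x y ≡ true}, and lab is the node labeling
-- (only its values on nodes are relevant).
-- Edges being a relation, there are never parallel edges with the
-- same source and target.

record NDigraph (N : Set) (L : Set) : Set where
  field
    node : N → Bool
    edge : N → N → Bool
    lab  : N → L
open NDigraph public

record LDigraph (N : Set) (Lv Le : Set) : Set where
  field
    lnode : N → Bool
    ledge : N → N → Le → Bool
    llab  : N → Lv
open LDigraph public

data ELab : Set where
  ht tt hh : ELab

WellFormed : ∀ {n L} → NDigraph (Fin n) L → Set
WellFormed G = ∀ u v → edge G u v ≡ true → (node G u ≡ true) × (node G v ≡ true)

Simple : ∀ {n L} → NDigraph (Fin n) L → Set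
Simple G = ∀ u → edge G u u ≡ false

Oriented : ∀ {n L} → NDigraph (Fin n) L → Set
Oriented G = ∀ u v → edge G u v ≡ true → edge G v u ≡ false

data UWalk {n L} (G : NDigraph (Fin n) L) : Fin n → Fin n → Set where
  here : ∀ {x} → UWalk G x x
  step : ∀ {x y z} → (edge G x y ∨ edge G y x) ≡ true → UWalk G y z → UWalk G x z

WeaklyConnected : ∀ {n L} → NDigraph (Fin n) L → Set
WeaklyConnected G = ∀ x y → node G x ≡ true → node G y ≡ true → UWalk G x y

_==_ : ∀ {n} → Fin n → Fin n → Bool
x == y = ⌊ x ≟ y ⌋

_==₂_ : ∀ {n} → Fin n × Fin n → Fin n × Fin n → Bool
(u , v) ==₂ (u' , v') = (u == u') ∧ (v == v')

lineCond : ∀ {n} → Fin n × Fin n → Fin n × Fin n → ELab → Bool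
lineCond (u , v) (u' , v') ht = v == u'
lineCond (u , v) (u' , v') tt = u == u'
lineCond (u , v) (u' , v') hh = v == v'

lineDigraph : ∀ {n L} → NDigraph (Fin n) L → LDigraph (Fin n × Fin n) (L × L) ELab
lnode (lineDigraph G) (u , v) = edge G u v
ledge (lineDigraph G) e e' t =
  not (e ==₂ e') ∧ lnode (lineDigraph G) e ∧ lnode (lineDigraph G) e' ∧ lineCond e e' t
llab  (lineDigraph G) (u , v) = (lab G u , lab G v)

edgeInduced : ∀ {n L} → NDigraph (Fin n) L → (Fin n → Fin n → Bool) → NDigraph (Fin n) L
node (edgeInduced {n} G W) x = any (λ y → W x y ∨ W y x) (allFin n)
edge (edgeInduced G W) = W
lab  (edgeInduced G W) = lab G

nodeInduced : ∀ {N Lv Le} → LDigraph N Lv Le → (N → Bool) → LDigraph N Lv Le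
lnode (nodeInduced G U) = U
ledge (nodeInduced G U) x y t = U x ∧ U y ∧ ledge G x y t
llab  (nodeInduced G U) = llab G

record _≐_ {N Lv Le} (A B : LDigraph N Lv Le) : Set where
  field
    nodes≡ : ∀ x → lnode A x ≡ lnode B x
    edges≡ : ∀ x y t → ledge A x y t ≡ ledge B x y t
    labs≡  : ∀ x → lnode A x ≡ true → llab A x ≡ llab B x

NodeOf : ∀ {N L} → NDigraph N L → Set
NodeOf {N} G = Σ N (λ x → node G x ≡ true)

LNodeOf : ∀ {N Lv Le} → LDigraph N Lv Le → Set
LNodeOf {N} G = Σ N (λ x → lnode G x ≡ true)

record _≅_ {N N' L} (G : NDigraph N L) (G' : NDigraph N' L) : Set where
  field
    to      : NodeOf G → NodeOf G'
    from    : NodeOf G' → NodeOf G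
    from-to : ∀ x → proj₁ (from (to x)) ≡ proj₁ x
    to-from : ∀ y → proj₁ (to (from y)) ≡ proj₁ y
    lab-pres  : ∀ x → lab G' (proj₁ (to x)) ≡ lab G (proj₁ x)
    edge-pres : ∀ x y → edge G' (proj₁ (to x)) (proj₁ (to y)) ≡ edge G (proj₁ x) (proj₁ y)

record _≅ₗ_ {N N' Lv Le} (G : LDigraph N Lv Le) (G' : LDigraph N' Lv Le) : Set where
  field
    to      : LNodeOf G → LNodeOf G'
    from    : LNodeOf G' → LNodeOf G
    from-to : ∀ x → proj₁ (from (to x)) ≡ proj₁ x
    to-from : ∀ y → proj₁ (to (from y)) ≡ proj₁ y
    lab-pres  : ∀ x → llab G' (proj₁ (to x)) ≡ llab G (proj₁ x)
    edge-pres : ∀ x y t → ledge G' (proj₁ (to x)) (proj₁ (to y)) t ≡ ledge G (proj₁ x) (proj₁ y) t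

-- Part (1) is a direct computation: on arcs of W, both digraphs have the same nodes, labels
-- and labelled edges. For part (2), an isomorphism φ : H ≅ H' sends each arc (u , v) of W to
-- the arc (φ u , φ v) of W'; since φ is injective this preserves which endpoints two arcs
-- share, and the labelled edges of J record exactly that. Conversely, an isomorphism
-- ψ : J ≅ J' sends a node x of H, written as an endpoint of some arc a, to the corresponding
-- endpoint of ψ a. This does not depend on the choice of a, because the labels tt, hh and ht
-- between distinct arcs say which endpoints they share, and for a single arc simplicity keeps
-- its tail and head apart.
module Submission where

open import Defs
open import Data.Nat using (ℕ)
open import Data.Fin using (Fin)
open import Data.Fin.Properties using (_≟_)
open import Data.Bool using (Bool; true; false; _∧_; not)
import Data.Bool.Properties as Bool
open import Data.Bool.Properties using (T-≡; T-∧; T-∨; ∧-zeroʳ; ∧-conicalʳ; ¬-not; ⇔→≡)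
open import Data.Product using (Σ; _,_; _×_; proj₁; proj₂)
open import Data.Product.Properties using (≡-dec)
open import Data.Sum using (_⊎_; inj₁; inj₂)
import Data.Sum as Sum
open import Data.List using (allFin)
open import Data.List.Relation.Unary.Any using (satisfied)
open import Data.List.Relation.Unary.Any.Properties using (any⁺; any⁻)
open import Data.List.Membership.Propositional using (lose)
open import Data.List.Membership.Propositional.Properties using (∈-allFin)
open import Data.Empty using (⊥-elim)
open import Function using (_∘_; _⇔_; mk⇔; Equivalence)
open import Axiom.UniquenessOfIdentityProofs using (module Decidable⇒UIP)
open import Relation.Nullary using (yes; no)
open import Relation.Nullary.Decidable using (isYes≗does; dec-true; dec-false; toWitness)
open import Relation.Binary.PropositionalEquality
  using (_≡_; _≢_; refl; sym; trans; cong; cong₂; subst₂; module ≡-Reasoning)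

≡-true-irrelevant : ∀ {b : Bool} (p q : b ≡ true) → p ≡ q
≡-true-irrelevant = Decidable⇒UIP.≡-irrelevant Bool._≟_

subset-≡ : ∀ {A : Set} {P : A → Bool} {a b : Σ A (λ x → P x ≡ true)} →
           proj₁ a ≡ proj₁ b → a ≡ b
subset-≡ {a = x , p} {.x , q} refl = cong (x ,_) (≡-true-irrelevant p q)

≡⇒== : ∀ {n} {x y : Fin n} → x ≡ y → x == y ≡ true
≡⇒== {x = x} {y} x≡y = trans (isYes≗does (x ≟ y)) (dec-true (x ≟ y) x≡y)

≢⇒==-false : ∀ {n} {x y : Fin n} → x ≢ y → x == y ≡ false
≢⇒==-false {x = x} {y} x≢y = trans (isYes≗does (x ≟ y)) (dec-false (x ≟ y) x≢y)

==⇒≡ : ∀ {n} {x y : Fin n} → x == y ≡ true → x ≡ y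
==⇒≡ {x = x} {y} eq = toWitness {a? = x ≟ y} (Equivalence.from T-≡ eq)

==-cong-⇔ : ∀ {m n} {x y : Fin m} {x' y' : Fin n} → x ≡ y ⇔ x' ≡ y' → x' == y' ≡ x == y
==-cong-⇔ {x = x} {y} x≡y⇔x'≡y' with x ≟ y
... | yes x≡y = ≡⇒== (Equivalence.to x≡y⇔x'≡y' x≡y)
... | no  x≢y = ≢⇒==-false (x≢y ∘ Equivalence.from x≡y⇔x'≡y')

==₂⇒≡ : ∀ {n} {p q : Fin n × Fin n} → p ==₂ q ≡ true → p ≡ q
==₂⇒≡ {p = u , v} {u' , v'} eq with Equivalence.to T-∧ (Equivalence.from T-≡ eq)
... | u==u' , v==v' = cong₂ _,_ (toWitness {a? = u ≟ u'} u==u') (toWitness {a? = v ≟ v'} v==v')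

≢⇒==₂-false : ∀ {n} {p q : Fin n × Fin n} → p ≢ q → p ==₂ q ≡ false
≢⇒==₂-false p≢q = ¬-not (p≢q ∘ ==₂⇒≡)

≅-sym : ∀ {N N' L} {G : NDigraph N L} {G' : NDigraph N' L} → G ≅ G' → G' ≅ G
≅-sym {G' = G'} i = record
  { to = from ; from = to ; from-to = to-from ; to-from = from-to
  ; lab-pres = λ y → trans (sym (lab-pres (from y))) (cong (lab G') (to-from y))
  ; edge-pres = λ x y → trans (sym (edge-pres (from x) (from y)))
                              (cong₂ (edge G') (to-from x) (to-from y))
  }
  where open _≅_ i

≅ₗ-sym : ∀ {N N' Lv Le} {A : LDigraph N Lv Le} {B : LDigraph N' Lv Le} → A ≅ₗ B → B ≅ₗ A
≅ₗ-sym {B = B} i = record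
  { to = from ; from = to ; from-to = to-from ; to-from = from-to
  ; lab-pres = λ y → trans (sym (lab-pres (from y))) (cong (llab B) (to-from y))
  ; edge-pres = λ x y t → trans (sym (edge-pres (from x) (from y) t))
                                (cong₂ (λ p q → ledge B p q t) (to-from x) (to-from y))
  }
  where open _≅ₗ_ i

module _ {N N' L} {G : NDigraph N L} {G' : NDigraph N' L} (i : G ≅ G') where
  open _≅_ i

  to-injective : ∀ x y → proj₁ (to x) ≡ proj₁ (to y) → proj₁ x ≡ proj₁ y
  to-injective x y eq =
    trans (sym (from-to x)) (trans (cong (proj₁ ∘ from) (subset-≡ eq)) (from-to y))

  from-to-any-proof : ∀ x (p : node G' (proj₁ (to x)) ≡ true) →
                      proj₁ (from (proj₁ (to x) , p)) ≡ proj₁ x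
  from-to-any-proof x p = trans (cong (proj₁ ∘ from) (subset-≡ refl)) (from-to x)

data End : Set where
  tail head : End

endpoint : ∀ {A : Set} → End → A × A → A
endpoint tail = proj₁
endpoint head = proj₂

-- LNodeOf (lineInduced G W) unfolds to Arc W, so arcs are passed directly to isomorphisms
-- between such digraphs.
Arc : ∀ {n} → (Fin n → Fin n → Bool) → Set
Arc {n} W = Σ (Fin n × Fin n) (λ e → W (proj₁ e) (proj₂ e) ≡ true)

lineInduced : ∀ {n L} → NDigraph (Fin n) L → (Fin n → Fin n → Bool) →
              LDigraph (Fin n × Fin n) (L × L) ELab
lineInduced G W = nodeInduced (lineDigraph G) (λ e → W (proj₁ e) (proj₂ e))

_⊆ᵉ_ : ∀ {n L} → (Fin n → Fin n → Bool) → NDigraph (Fin n) L → Set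
W ⊆ᵉ G = ∀ u v → W u v ≡ true → edge G u v ≡ true

record Incidence {n} (W : Fin n → Fin n → Bool) (x : Fin n) : Set where
  constructor incidence
  field
    arc   : Arc W
    side  : End
    meets : endpoint side (proj₁ arc) ≡ x

module _ {n L} (G : NDigraph (Fin n) L) (W : Fin n → Fin n → Bool) where

  incident⇒node : ∀ {x} y → W x y ≡ true ⊎ W y x ≡ true → node (edgeInduced G W) x ≡ true
  incident⇒node y xy⊎yx = Equivalence.to T-≡ (any⁺ _ (lose (∈-allFin y)
    (Equivalence.from T-∨ (Sum.map (Equivalence.from T-≡) (Equivalence.from T-≡) xy⊎yx))))

  endpoint-node : (a : Arc W) (s : End) → node (edgeInduced G W) (endpoint s (proj₁ a)) ≡ true
  endpoint-node ((u , v) , w) tail = incident⇒node v (inj₁ w)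
  endpoint-node ((u , v) , w) head = incident⇒node u (inj₂ w)

  endpointOf : Arc W → End → NodeOf (edgeInduced G W)
  endpointOf a s = endpoint s (proj₁ a) , endpoint-node a s

  incidenceOf : (x : NodeOf (edgeInduced G W)) → Incidence W (proj₁ x)
  incidenceOf (x , p) with satisfied (any⁻ _ (allFin n) (Equivalence.from T-≡ p))
  ... | y , incident with Equivalence.to T-∨ incident
  ...   | inj₁ xy = incidence ((x , y) , Equivalence.to T-≡ xy) tail refl
  ...   | inj₂ yx = incidence ((y , x) , Equivalence.to T-≡ yx) head refl

  lineDigraph-edgeInduced : W ⊆ᵉ G → lineDigraph (edgeInduced G W) ≐ lineInduced G W
  lineDigraph-edgeInduced W⊆G = record
    { nodes≡ = λ _ → refl ; edges≡ = edges≡ ; labs≡ = λ _ _ → refl }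
    where
    edges≡ : ∀ e e' t → ledge (lineDigraph (edgeInduced G W)) e e' t ≡ ledge (lineInduced G W) e e' t
    edges≡ (u , v) (u' , v') t with W u v in w | W u' v' in w'
    ... | true  | true  rewrite W⊆G u v w | W⊆G u' v' w' = refl
    ... | true  | false = ∧-zeroʳ (not ((u , v) ==₂ (u' , v')))
    ... | false | _     = ∧-zeroʳ (not ((u , v) ==₂ (u' , v')))

  ledge-lineInduced : W ⊆ᵉ G → (a b : Arc W) (t : ELab) →
    ledge (lineInduced G W) (proj₁ a) (proj₁ b) t ≡
    not (proj₁ a ==₂ proj₁ b) ∧ lineCond (proj₁ a) (proj₁ b) t
  ledge-lineInduced W⊆G ((u , v) , w) ((u' , v') , w') t
    rewrite w | w' | W⊆G u v w | W⊆G u' v' w' = refl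

module ArcMap {n n' L} (G : NDigraph (Fin n) L) (G' : NDigraph (Fin n') L)
  (W : Fin n → Fin n → Bool) (W' : Fin n' → Fin n' → Bool)
  (i : edgeInduced G W ≅ edgeInduced G' W') where
  open _≅_ i

  mapArc : Arc W → Arc W'
  mapArc a = (proj₁ (to (endpointOf G W a tail)) , proj₁ (to (endpointOf G W a head))) ,
             trans (edge-pres _ _) (proj₂ a)

  ==-to : ∀ x y → proj₁ (to x) == proj₁ (to y) ≡ proj₁ x == proj₁ y
  ==-to x y = ==-cong-⇔ (mk⇔ (cong (proj₁ ∘ to) ∘ subset-≡) (to-injective i x y))

  ==₂-mapArc : ∀ a b → proj₁ (mapArc a) ==₂ proj₁ (mapArc b) ≡ proj₁ a ==₂ proj₁ b
  ==₂-mapArc a b = cong₂ _∧_ (==-to (endpointOf G W a tail) (endpointOf G W b tail))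
                             (==-to (endpointOf G W a head) (endpointOf G W b head))

  lineCond-mapArc : ∀ a b t →
    lineCond (proj₁ (mapArc a)) (proj₁ (mapArc b)) t ≡ lineCond (proj₁ a) (proj₁ b) t
  lineCond-mapArc a b ht = ==-to (endpointOf G W a head) (endpointOf G W b tail)
  lineCond-mapArc a b tt = ==-to (endpointOf G W a tail) (endpointOf G W b tail)
  lineCond-mapArc a b hh = ==-to (endpointOf G W a head) (endpointOf G W b head)

  ledge-mapArc : W ⊆ᵉ G → W' ⊆ᵉ G' → ∀ a b t →
    ledge (lineInduced G' W') (proj₁ (mapArc a)) (proj₁ (mapArc b)) t ≡
    ledge (lineInduced G W) (proj₁ a) (proj₁ b) t
  ledge-mapArc W⊆G W'⊆G' a b t = begin
    ledge (lineInduced G' W') (proj₁ (mapArc a)) (proj₁ (mapArc b)) t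
      ≡⟨ ledge-lineInduced G' W' W'⊆G' (mapArc a) (mapArc b) t ⟩
    not (proj₁ (mapArc a) ==₂ proj₁ (mapArc b)) ∧ lineCond (proj₁ (mapArc a)) (proj₁ (mapArc b)) t
      ≡⟨ cong₂ (λ p q → not p ∧ q) (==₂-mapArc a b) (lineCond-mapArc a b t) ⟩
    not (proj₁ a ==₂ proj₁ b) ∧ lineCond (proj₁ a) (proj₁ b) t
      ≡⟨ ledge-lineInduced G W W⊆G a b t ⟨
    ledge (lineInduced G W) (proj₁ a) (proj₁ b) t
      ∎
    where open ≡-Reasoning

  llab-mapArc : ∀ a → llab (lineInduced G' W') (proj₁ (mapArc a)) ≡ llab (lineInduced G W) (proj₁ a)
  llab-mapArc a = cong₂ _,_ (lab-pres (endpointOf G W a tail)) (lab-pres (endpointOf G W a head))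

mapArc-inverse : ∀ {n n' L} (G : NDigraph (Fin n) L) (G' : NDigraph (Fin n') L)
  (W : Fin n → Fin n → Bool) (W' : Fin n' → Fin n' → Bool)
  (i : edgeInduced G W ≅ edgeInduced G' W') (a : Arc W) →
  proj₁ (ArcMap.mapArc G' G W' W (≅-sym i) (ArcMap.mapArc G G' W W' i a)) ≡ proj₁ a
mapArc-inverse G G' W W' i a =
  cong₂ _,_ (from-to-any-proof i (endpointOf G W a tail) _) (from-to-any-proof i (endpointOf G W a head) _)

≅⇒≅ₗ : ∀ {n n' L} (G : NDigraph (Fin n) L) (G' : NDigraph (Fin n') L)
  (W : Fin n → Fin n → Bool) (W' : Fin n' → Fin n' → Bool) →
  W ⊆ᵉ G → W' ⊆ᵉ G' →
  edgeInduced G W ≅ edgeInduced G' W' → lineInduced G W ≅ₗ lineInduced G' W'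
≅⇒≅ₗ G G' W W' W⊆G W'⊆G' i = record
  { to = mapArc ; from = ArcMap.mapArc G' G W' W (≅-sym i)
  ; from-to = mapArc-inverse G G' W W' i ; to-from = mapArc-inverse G' G W' W (≅-sym i)
  ; lab-pres = llab-mapArc ; edge-pres = ledge-mapArc W⊆G W'⊆G'
  }
  where open ArcMap G G' W W' i

endpoints-distinct : ∀ {n L} (G : NDigraph (Fin n) L) (W : Fin n → Fin n → Bool) →
  W ⊆ᵉ G → Simple G →
  (a : Arc W) {s s' : End} → endpoint s (proj₁ a) ≡ endpoint s' (proj₁ a) → s ≡ s'
endpoints-distinct G W W⊆G simple ((u , v) , w) {s} {s'} = distinct s s'
  where
  no-loop : u ≢ v
  no-loop refl with () ← trans (sym (W⊆G u u w)) (simple u)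

  distinct : ∀ s s' → endpoint s (u , v) ≡ endpoint s' (u , v) → s ≡ s'
  distinct tail tail _   = refl
  distinct head head _   = refl
  distinct tail head u≡v = ⊥-elim (no-loop u≡v)
  distinct head tail v≡u = ⊥-elim (no-loop (sym v≡u))

module NodeMap {n n' L} (G : NDigraph (Fin n) L) (G' : NDigraph (Fin n') L)
  (W : Fin n → Fin n → Bool) (W' : Fin n' → Fin n' → Bool)
  (W⊆G : W ⊆ᵉ G) (W'⊆G' : W' ⊆ᵉ G') (simple : Simple G)
  (i : lineInduced G W ≅ₗ lineInduced G' W') where
  open _≅ₗ_ i

  lineCond-pres : ∀ a b t → proj₁ a ≢ proj₁ b → lineCond (proj₁ a) (proj₁ b) t ≡ true →
                  lineCond (proj₁ (to a)) (proj₁ (to b)) t ≡ true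
  lineCond-pres a b t a≢b cond = ∧-conicalʳ _ _ (begin
    not (proj₁ (to a) ==₂ proj₁ (to b)) ∧ lineCond (proj₁ (to a)) (proj₁ (to b)) t
      ≡⟨ ledge-lineInduced G' W' W'⊆G' (to a) (to b) t ⟨
    ledge (lineInduced G' W') (proj₁ (to a)) (proj₁ (to b)) t
      ≡⟨ edge-pres a b t ⟩
    ledge (lineInduced G W) (proj₁ a) (proj₁ b) t
      ≡⟨ ledge-lineInduced G W W⊆G a b t ⟩
    not (proj₁ a ==₂ proj₁ b) ∧ lineCond (proj₁ a) (proj₁ b) t
      ≡⟨ cong₂ (λ p q → not p ∧ q) (≢⇒==₂-false a≢b) cond ⟩
    true
      ∎)
    where open ≡-Reasoning

  shared-endpoint : ∀ a b s s' → endpoint s (proj₁ a) ≡ endpoint s' (proj₁ b) →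
                    endpoint s (proj₁ (to a)) ≡ endpoint s' (proj₁ (to b))
  shared-endpoint a b s s' eq with ≡-dec _≟_ _≟_ (proj₁ a) (proj₁ b)
  ... | yes a≡b with subset-≡ {a = a} {b} a≡b
  ...   | refl with endpoints-distinct G W W⊆G simple a {s} {s'} eq
  ...     | refl = refl
  shared-endpoint a b tail tail eq | no a≢b = ==⇒≡ (lineCond-pres a b tt a≢b (≡⇒== eq))
  shared-endpoint a b head head eq | no a≢b = ==⇒≡ (lineCond-pres a b hh a≢b (≡⇒== eq))
  shared-endpoint a b head tail eq | no a≢b = ==⇒≡ (lineCond-pres a b ht a≢b (≡⇒== eq))
  shared-endpoint a b tail head eq | no a≢b =
    sym (==⇒≡ (lineCond-pres b a ht (a≢b ∘ sym) (≡⇒== (sym eq))))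

  nodeMap : NodeOf (edgeInduced G W) → NodeOf (edgeInduced G' W')
  nodeMap x = endpointOf G' W' (to arc) side
    where open Incidence (incidenceOf G W x)

  nodeMap-endpoint : ∀ x a s → endpoint s (proj₁ a) ≡ proj₁ x →
                     proj₁ (nodeMap x) ≡ endpoint s (proj₁ (to a))
  nodeMap-endpoint x a s eq = shared-endpoint arc a side s (trans meets (sym eq))
    where open Incidence (incidenceOf G W x)

  lab-endpoint : ∀ a s → lab G' (endpoint s (proj₁ (to a))) ≡ lab G (endpoint s (proj₁ a))
  lab-endpoint a tail = cong proj₁ (lab-pres a)
  lab-endpoint a head = cong proj₂ (lab-pres a)

  nodeMap-lab : ∀ x → lab G' (proj₁ (nodeMap x)) ≡ lab G (proj₁ x)
  nodeMap-lab x = trans (lab-endpoint arc side) (cong (lab G) meets)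
    where open Incidence (incidenceOf G W x)

  nodeMap-arc : ∀ x y → W (proj₁ x) (proj₁ y) ≡ true →
                W' (proj₁ (nodeMap x)) (proj₁ (nodeMap y)) ≡ true
  nodeMap-arc x y w = subst₂ (λ u v → W' u v ≡ true)
    (sym (nodeMap-endpoint x a tail refl)) (sym (nodeMap-endpoint y a head refl)) (proj₂ (to a))
    where
    a : Arc W
    a = (proj₁ x , proj₁ y) , w

module _ {n n' L} (G : NDigraph (Fin n) L) (G' : NDigraph (Fin n') L)
  (W : Fin n → Fin n → Bool) (W' : Fin n' → Fin n' → Bool)
  (W⊆G : W ⊆ᵉ G) (W'⊆G' : W' ⊆ᵉ G') (simple : Simple G) (simple' : Simple G')
  (i : lineInduced G W ≅ₗ lineInduced G' W') where
  private
    module A = NodeMap G G' W W' W⊆G W'⊆G' simple i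
    module B = NodeMap G' G W' W W'⊆G' W⊆G simple' (≅ₗ-sym i)

  nodeMap-inverse : ∀ x → proj₁ (B.nodeMap (A.nodeMap x)) ≡ proj₁ x
  nodeMap-inverse x = begin
    proj₁ (B.nodeMap (A.nodeMap x))        ≡⟨ B.nodeMap-endpoint (A.nodeMap x) (to arc) side refl ⟩
    endpoint side (proj₁ (from (to arc))) ≡⟨ cong (endpoint side) (from-to arc) ⟩
    endpoint side (proj₁ arc)             ≡⟨ meets ⟩
    proj₁ x                               ∎
    where
    open ≡-Reasoning
    open _≅ₗ_ i
    open Incidence (incidenceOf G W x)

  nodeMap-edge : ∀ x y → W' (proj₁ (A.nodeMap x)) (proj₁ (A.nodeMap y)) ≡ W (proj₁ x) (proj₁ y)
  nodeMap-edge x y = ⇔→≡ (mk⇔ reflect (A.nodeMap-arc x y))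
    where
    reflect : W' (proj₁ (A.nodeMap x)) (proj₁ (A.nodeMap y)) ≡ true →
              W (proj₁ x) (proj₁ y) ≡ true
    reflect = subst₂ (λ u v → W u v ≡ true) (nodeMap-inverse x) (nodeMap-inverse y)
            ∘ B.nodeMap-arc (A.nodeMap x) (A.nodeMap y)

≅ₗ⇒≅ : ∀ {n n' L} (G : NDigraph (Fin n) L) (G' : NDigraph (Fin n') L)
  (W : Fin n → Fin n → Bool) (W' : Fin n' → Fin n' → Bool) →
  W ⊆ᵉ G → W' ⊆ᵉ G' → Simple G → Simple G' →
  lineInduced G W ≅ₗ lineInduced G' W' → edgeInduced G W ≅ edgeInduced G' W'
≅ₗ⇒≅ G G' W W' W⊆G W'⊆G' simple simple' i = record
  { to = NodeMap.nodeMap G G' W W' W⊆G W'⊆G' simple i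
  ; from = NodeMap.nodeMap G' G W' W W'⊆G' W⊆G simple' (≅ₗ-sym i)
  ; from-to = nodeMap-inverse G G' W W' W⊆G W'⊆G' simple simple' i
  ; to-from = nodeMap-inverse G' G W' W W'⊆G' W⊆G simple' simple (≅ₗ-sym i)
  ; lab-pres = NodeMap.nodeMap-lab G G' W W' W⊆G W'⊆G' simple i
  ; edge-pres = nodeMap-edge G G' W W' W⊆G W'⊆G' simple simple' i
  }

lemma5p2 : {L : Set} {n n' : ℕ}
    (G : NDigraph (Fin n) L) (G' : NDigraph (Fin n') L) →
    WellFormed G → WeaklyConnected G → Simple G → Oriented G →
    WellFormed G' → WeaklyConnected G' → Simple G' → Oriented G' →
    (W : Fin n → Fin n → Bool) (W' : Fin n' → Fin n' → Bool) →
    (∀ u v → W u v ≡ true → edge G u v ≡ true) →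
    (∀ u v → W' u v ≡ true → edge G' u v ≡ true) →
    let H  = edgeInduced G W
        H' = edgeInduced G' W'
        J  = nodeInduced (lineDigraph G) (λ e → W (proj₁ e) (proj₂ e))
        J' = nodeInduced (lineDigraph G') (λ e → W' (proj₁ e) (proj₂ e))
    in ((lineDigraph H ≐ J) × (lineDigraph H' ≐ J'))
       × ((H ≅ H' → J ≅ₗ J') × (J ≅ₗ J' → H ≅ H'))
lemma5p2 G G' _ _ simple _ _ _ simple' _ W W' W⊆G W'⊆G' =
  (lineDigraph-edgeInduced G W W⊆G , lineDigraph-edgeInduced G' W' W'⊆G') ,
  (≅⇒≅ₗ G G' W W' W⊆G W'⊆G' , ≅ₗ⇒≅ G G' W W' W⊆G W'⊆G' simple simple')
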